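{- Let $D$ be a positive square-free integer, $K=\mathbb{Q}(\sqrt{D})$, and let $p>2$ be a prime that splits in $K$. Let $t=a+b\sqrt{D}$ be a unit of $\mathcal{O}_K$ with $a,b\in\mathbb{Z}[\tfrac12]$. Assume that the norm $N_{K/\mathbb{Q}}(t)=-1$ and that $p\mid a$. Then \[ t^{p-1}\equiv 1\pmod{p^2}\iff a\equiv 0\pmod{p^2}. \]
   Context: Here $t^{p-1}\equiv 1\pmod{p^2}$ means $t^{p-1}\equiv 1 \pmod{p^2\mathcal{O}_K}$ (equivalently, modulo $p^2\mathbb{Z}_p$ after embedding $K$ into $\mathbb{Q}_p$ via either prime above $p$; these are equivalent). Since $p$ is odd, divisibility of $a\in\mathbb{Z}[\tfrac12]$ by $p$ or $p^2$ is taken in $\mathbb{Z}[\tfrac12]$. -}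

module Defs where

open import Data.Nat as ℕ using (ℕ; zero; suc)
open import Data.Nat.Primality using (Prime)
open import Data.Integer as ℤ using (ℤ; +_; -_; _+_; _-_; _*_; _^_)
open import Data.Integer.Divisibility as ℤD using ()
open import Data.Product using (_×_; _,_; Σ; ∃; ∃-syntax; proj₁; proj₂)
open import Data.Empty using (⊥)
open import Relation.Nullary using (¬_)
open import Relation.Binary.PropositionalEquality using (_≡_)

SquareFree : ℕ → Set
SquareFree D = ∀ (m : ℕ) → (m ℕ.* m) Data.Nat.Divisibility.∣ D → m ≡ 1
  where import Data.Nat.Divisibility

-- Arithmetic in ℤ[√D]; a pair (x , y) stands for x + y√D.
mulD : ℤ → ℤ × ℤ → ℤ × ℤ → ℤ × ℤ
mulD D (x , y) (u , v) = (x * u + D * (y * v) , x * v + y * u)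

powD : ℤ → ℤ × ℤ → ℕ → ℤ × ℤ
powD D t zero    = (+ 1 , + 0)
powD D t (suc n) = mulD D t (powD D t n)

-- Every element of O_K lies in ½ℤ[√D]; we write such an element as
-- (x + y√D)/2 with x y : ℤ.  It is integral (lies in O_K) iff its
-- trace x and norm (x² − D y²)/4 are integers.
InOK : ℤ → ℤ → ℤ → Set
InOK D x y = (+ 4) ℤD.∣ (x * x - D * (y * y))

HasNorm : ℤ → ℤ → ℤ → ℤ → Set
HasNorm D x y n = x * x - D * (y * y) ≡ (+ 4) * n

IsUnitOK : ℤ → ℤ → ℤ → Set
IsUnitOK D x y = InOK D x y ×
  ∃[ u ] ∃[ v ] (InOK D u v × mulD D (x , y) (u , v) ≡ (+ 4 , + 0))

-- p splits in K = ℚ(√D) (p odd prime): D is a nonzero square modulo p.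
SplitsIn : ℕ → ℕ → Set
SplitsIn p D = ¬ ((+ p) ℤD.∣ (+ D)) × ∃[ x ] ((+ p) ℤD.∣ (x * x - + D))

-- Divisibility in ℤ[½]: the element A/2 of ℤ[½] is divisible by m in ℤ[½],
-- i.e. A/2 = m · (C / 2^k) for some C : ℤ, k : ℕ.
DivZHalf : ℤ → ℤ → Set
DivZHalf m A = ∃[ C ] ∃[ k ] (A * (+ 2) ^ k ≡ (+ 2) * (m * C))

-- Congruence t^n ≡ 1 (mod m · O_K) for t = (A + B√D)/2:
-- t^n − 1 = m · (x + y√D)/2 with (x + y√D)/2 ∈ O_K.
-- Writing (A + B√D)^n = X + Y√D, t^n = (X + Y√D)/2^n, so the equation is
-- 2 (X − 2^n) = 2^n m x  and  2 Y = 2^n m y.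
PowCongOne : ℤ → ℤ → ℤ → ℕ → ℤ → Set
PowCongOne D A B n m =
  ∃[ x ] ∃[ y ] (InOK D x y ×
    ((+ 2) * (proj₁ (powD D (A , B) n) - (+ 2) ^ n) ≡ (+ 2) ^ n * (m * x)) ×
    ((+ 2) * proj₂ (powD D (A , B) n) ≡ (+ 2) ^ n * (m * y)))

{-# OPTIONS --safe #-}
-- Since t = (A + B√D)/2 has trace A and norm −1, its powers are t^n = (V n + B U n √D)/2 for the
-- Lucas sequences U, V with parameters (A, −1), which satisfy U (n + 2) = A U (n + 1) + U n.
-- Reducing this recurrence modulo A gives, for p = 2m + 1, V (2m) ≡ 2 and U (2m) ≡ 0 mod A, and
-- more precisely U (2m) ≡ m A mod A². As t^(p−1) has norm 1 and p is odd, t^(p−1) ≡ 1 mod p²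
-- amounts to p² ∣ V (2m) − 2 and p² ∣ B U (2m). Both hold when p² ∣ A. Conversely they give
-- p² ∣ B m A, and p ∤ B (otherwise p ∣ A² − D B² = −4) and p ∤ m, so p ∣ A / p. Finally,
-- divisibility of A/2 by the odd numbers p and p² in ℤ[½] is ordinary divisibility of A.
module Submission where

open import Defs
open import Data.Nat as ℕ using (ℕ; _∸_)
open import Data.Nat.Primality using (Prime)
open import Data.Integer as ℤ using (ℤ; +_; -_; _*_)
open import Relation.Binary.PropositionalEquality using (_≡_)
open import Function.Bundles using (_⇔_)

open import Data.Nat using (zero; suc)
import Data.Nat.Properties as ℕ
import Data.Nat.Divisibility as ℕ
import Data.Nat.Coprimality as ℕ
open import Data.Nat.Coprimality using (prime⇒coprime)
open import Data.Nat.DivMod using (_%_; _/_; m≡m%n+[m/n]*n; m%n<n)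
open import Data.Nat.Primality using (euclidsLemma; prime⇒nonZero; composite)
open import Data.Integer using (_+_; _-_; _^_; ∣_∣; NonZero; 0ℤ; 1ℤ; -1ℤ)
open import Data.Integer.Properties using (abs-*; *-comm; *-assoc; *-identityˡ; *-cancelˡ-≡; i*j≢0)
open import Data.Integer.Divisibility.Signed
  using (_∣_; divides; ∣ᵤ⇒∣; ∣⇒∣ᵤ; ∣-refl; ∣-trans; ∣m∣n⇒∣m+n; ∣m∣n⇒∣m-n; ∣m⇒∣m*n; ∣n⇒∣m*n;
         *-monoʳ-∣; *-monoˡ-∣; *-cancelʳ-∣)
open import Data.Integer.Coprimality as ℤ using (Coprime)
open import Data.Integer.Tactic.RingSolver using (solve-∀)
open import Data.Product using (_×_; _,_; ∃-syntax; proj₁; proj₂)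
open import Data.Sum using (inj₁; inj₂; reduce)
open import Function.Base using (_∘_)
open import Function.Bundles using (mk⇔; Equivalence)
open import Function.Properties.Equivalence using (⇔-setoid) renaming (trans to ⇔-trans)
open import Level using (0ℓ)
open import Relation.Nullary using (¬_; contradiction)
open import Relation.Binary.PropositionalEquality
  using (refl; sym; trans; cong; cong₂; subst; module ≡-Reasoning)
import Relation.Binary.Reasoning.Setoid as ⇔-Reasoning

private
  variable
    i j k A B D M : ℤ
    m p : ℕ

^-nonZero : ∀ i n .{{_ : NonZero i}} → NonZero (i ^ n)
^-nonZero i zero    = _
^-nonZero i (suc n) = i*j≢0 i (i ^ n)
  where
  instance
    i^n≢0 : NonZero (i ^ n)
    i^n≢0 = ^-nonZero i n

-1^even≡1 : ∀ m → -1ℤ ^ (m ℕ.* 2) ≡ 1ℤ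
-1^even≡1 zero    = refl
-1^even≡1 (suc m) = cong (λ z → -1ℤ * (-1ℤ * z)) (-1^even≡1 m)

coprime-*ˡ : Coprime i k → Coprime j k → Coprime (i * j) k
coprime-*ˡ {i} {k} {j} c₁ c₂ {d} (d∣ij , d∣k) = c₂ (d∣j , d∣k)
  where
  d∣j : d ℕ.∣ ∣ j ∣
  d∣j = ℕ.coprime-factors c₁ (subst (d ℕ.∣_) (abs-* i j) d∣ij , ℕ.∣-trans d∣k (ℕ.m∣m*n ∣ j ∣))

coprime-*ʳ : Coprime k i → Coprime k j → Coprime k (i * j)
coprime-*ʳ {k} {i} {j} c₁ c₂ =
  ℤ.sym {i * j} {k} (coprime-*ˡ {i} {k} {j} (ℤ.sym {k} {i} c₁) (ℤ.sym {k} {j} c₂))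

coprime-divisor : Coprime i j → i ∣ j * k → i ∣ k
coprime-divisor {i} {j} {k} c = ∣ᵤ⇒∣ ∘ ℤ.coprime-divisor i j k c ∘ ∣⇒∣ᵤ

coprime-divisor-^ : Coprime i j → ∀ n → i ∣ j ^ n * k → i ∣ k
coprime-divisor-^ {k = k} _ zero i∣k = subst (_ ∣_) (*-identityˡ k) i∣k
coprime-divisor-^ {i} {j} {k} c (suc n) i∣jⁿ⁺¹k =
  coprime-divisor-^ {i} {j} c n (coprime-divisor {i} {j} c (subst (i ∣_) (*-assoc j (j ^ n) k) i∣jⁿ⁺¹k))

euclidsLemma-∤ : Prime p → ¬ (+ p ∣ i) → + p ∣ i * j → + p ∣ j
euclidsLemma-∤ {p} {i} {j} p-prime p∤i p∣ij
  with euclidsLemma ∣ i ∣ ∣ j ∣ p-prime (subst (p ℕ.∣_) (abs-* i j) (∣⇒∣ᵤ p∣ij))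
... | inj₁ p∣i = contradiction (∣ᵤ⇒∣ p∣i) p∤i
... | inj₂ p∣j = ∣ᵤ⇒∣ p∣j

odd-prime : Prime p → 2 ℕ.< p → ∃[ m ] p ≡ suc (m ℕ.* 2)
odd-prime {p} p-prime 2<p with p % 2 | m≡m%n+[m/n]*n p 2 | m%n<n p 2
... | 0           | p≡[p/2]*2   | _ =
  contradiction (composite 2<p (ℕ.divides (p / 2) p≡[p/2]*2)) (Prime.notComposite p-prime)
... | 1           | p≡1+[p/2]*2 | _ = p / 2 , p≡1+[p/2]*2
... | suc (suc _) | _           | ℕ.s≤s (ℕ.s≤s ())

odd∤half : 2 ℕ.< suc (m ℕ.* 2) → ¬ (+ suc (m ℕ.* 2) ∣ + m)
odd∤half {zero}  (ℕ.s≤s ())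
odd∤half {suc m} _ p∣m = ℕ.<⇒≱ (ℕ.s≤s (ℕ.m≤m*n (suc m) 2)) (ℕ.∣⇒≤ (∣⇒∣ᵤ p∣m))

prime²-coprime-2 : Prime p → 2 ℕ.< p → Coprime (+ p * + p) (+ 2)
prime²-coprime-2 {p} p-prime 2<p = coprime-*ˡ {+ p} {+ 2} {+ p} p⊥2 p⊥2
  where
  p⊥2 : Coprime (+ p) (+ 2)
  p⊥2 = prime⇒coprime p-prime 2<p

divZHalf⇔∣ : Coprime M (+ 2) → DivZHalf M A ⇔ M ∣ A
divZHalf⇔∣ {M} {A} M-odd = mk⇔ to from
  where
  open ≡-Reasoning
  to : DivZHalf M A → M ∣ A
  to (C , k , eq) = coprime-divisor-^ {M} {+ 2} M-odd k (divides (+ 2 * C) (begin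
    (+ 2) ^ k * A  ≡⟨ *-comm ((+ 2) ^ k) A ⟩
    A * (+ 2) ^ k  ≡⟨ eq ⟩
    + 2 * (M * C)  ≡⟨ cong (+ 2 *_) (*-comm M C) ⟩
    + 2 * (C * M)  ≡⟨ *-assoc (+ 2) C M ⟨
    + 2 * C * M    ∎))
  from : M ∣ A → DivZHalf M A
  from (divides c eq) = c , 1 , trans (*-comm A (+ 2)) (cong (+ 2 *_) (trans eq (*-comm c M)))

infix 4 _≡_mod_
_≡_mod_ : ℤ → ℤ → ℤ → Set
x ≡ y mod M = M ∣ x - y

lucasU : (P Q : ℤ) → ℕ → ℤ
lucasU P Q zero          = 0ℤ
lucasU P Q (suc zero)    = 1ℤ
lucasU P Q (suc (suc n)) = P * lucasU P Q (suc n) - Q * lucasU P Q n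

-- The standard identity V n = 2 U (n + 1) − P U n, taken as the definition of V.
lucasV : (P Q : ℤ) → ℕ → ℤ
lucasV P Q n = + 2 * lucasU P Q (suc n) - P * lucasU P Q n

discriminant : ℤ → ℤ → ℤ
discriminant P Q = P * P - + 4 * Q

lucasV-suc : ∀ P Q n →
  + 2 * lucasV P Q (suc n) ≡ P * lucasV P Q n + discriminant P Q * lucasU P Q n
lucasV-suc P Q n = regroup P Q (lucasU P Q (suc n)) (lucasU P Q n)
  where
  regroup : ∀ P Q a b →
    + 2 * (+ 2 * (P * a - Q * b) - P * a) ≡ P * (+ 2 * a - P * b) + (P * P - + 4 * Q) * b
  regroup = solve-∀

lucas-norm : ∀ P Q n →
  lucasV P Q n * lucasV P Q n - discriminant P Q * (lucasU P Q n * lucasU P Q n) ≡ Q ^ n * + 4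
lucas-norm P Q zero    = base P Q
  where
  base : ∀ P Q →
    (+ 2 * 1ℤ - P * 0ℤ) * (+ 2 * 1ℤ - P * 0ℤ) - (P * P - + 4 * Q) * (0ℤ * 0ℤ) ≡ 1ℤ * + 4
  base = solve-∀
lucas-norm P Q (suc n) = begin
  V (suc n) * V (suc n) - discriminant P Q * (U (suc n) * U (suc n))
    ≡⟨ step P Q (U (suc n)) (U n) ⟩
  Q * (V n * V n - discriminant P Q * (U n * U n))
    ≡⟨ cong (Q *_) (lucas-norm P Q n) ⟩
  Q * (Q ^ n * + 4)
    ≡⟨ *-assoc Q (Q ^ n) (+ 4) ⟨
  Q ^ suc n * + 4
    ∎
  where
  open ≡-Reasoning
  U V : ℕ → ℤ
  U = lucasU P Q
  V = lucasV P Q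
  step : ∀ P Q a b →
    (+ 2 * (P * a - Q * b) - P * a) * (+ 2 * (P * a - Q * b) - P * a) - (P * P - + 4 * Q) * (a * a)
      ≡ Q * ((+ 2 * a - P * b) * (+ 2 * a - P * b) - (P * P - + 4 * Q) * (b * b))
  step = solve-∀

module _ (P : ℤ) where
  private
    U V : ℕ → ℤ
    U = lucasU P -1ℤ
    V = lucasV P -1ℤ

  P∣lucasU-even : ∀ j → P ∣ U (j ℕ.* 2)
  P∣lucasU-even zero    = divides 0ℤ refl
  P∣lucasU-even (suc j) = ∣m∣n⇒∣m-n (∣m⇒∣m*n _ ∣-refl) (∣n⇒∣m*n -1ℤ (P∣lucasU-even j))

  lucasU-odd≡1 : ∀ j → U (suc (j ℕ.* 2)) ≡ 1ℤ mod P
  lucasU-odd≡1 zero    = divides 0ℤ refl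
  lucasU-odd≡1 (suc j) =
    subst (P ∣_) (sym (regroup P _ _)) (∣m∣n⇒∣m+n (∣m⇒∣m*n _ ∣-refl) (lucasU-odd≡1 j))
    where
    regroup : ∀ P a b → P * a - -1ℤ * b - 1ℤ ≡ P * a + (b - 1ℤ)
    regroup = solve-∀

  lucasU-even≡jP : ∀ j → U (j ℕ.* 2) ≡ + j * P mod P * P
  lucasU-even≡jP zero    = divides 0ℤ refl
  lucasU-even≡jP (suc j) =
    subst (P * P ∣_) (sym (regroup P _ _ (+ j)))
      (∣m∣n⇒∣m+n (*-monoʳ-∣ P (lucasU-odd≡1 j)) (lucasU-even≡jP j))
    where
    regroup : ∀ P a b j → P * a - -1ℤ * b - (+ 1 + j) * P ≡ P * (a - 1ℤ) + (b - j * P)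
    regroup = solve-∀

  lucasV-even≡2 : ∀ j → V (j ℕ.* 2) ≡ + 2 mod P
  lucasV-even≡2 j =
    subst (P ∣_) (sym (regroup P (U (suc (j ℕ.* 2))) (U (j ℕ.* 2))))
      (∣m∣n⇒∣m-n (∣n⇒∣m*n (+ 2) (lucasU-odd≡1 j)) (∣m⇒∣m*n _ ∣-refl))
    where
    regroup : ∀ P a b → + 2 * a - P * b - + 2 ≡ + 2 * (a - 1ℤ) - P * b
    regroup = solve-∀

-- (V + W√D)/2 − 1 = M (x + y√D)/2 with (x + y√D)/2 ∈ O_K, i.e. (V + W√D)/2 ≡ 1 mod M O_K.
CongOne : (D V W M : ℤ) → Set
CongOne D V W M = ∃[ x ] ∃[ y ] (InOK D x y × V - + 2 ≡ M * x × W ≡ M * y)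

module _ {D A B Q : ℤ} (norm : HasNorm D A B Q) where
  private
    U V X Y : ℕ → ℤ
    U = lucasU A Q
    V = lucasV A Q
    X n = proj₁ (powD D (A , B) n)
    Y n = proj₂ (powD D (A , B) n)

  open ≡-Reasoning

  discriminant≡DB² : discriminant A Q ≡ D * (B * B)
  discriminant≡DB² = begin
    A * A - + 4 * Q                ≡⟨ cong (_-_ (A * A)) norm ⟨
    A * A - (A * A - D * (B * B))  ≡⟨ cancel (A * A) (D * (B * B)) ⟩
    D * (B * B)                    ∎
    where
    cancel : ∀ a b → a - (a - b) ≡ b
    cancel = solve-∀

  powD≡lucas : ∀ n → + 2 * X n ≡ (+ 2) ^ n * V n × + 2 * Y n ≡ (+ 2) ^ n * (B * U n)
  powD≡lucas zero    = base₁ A , base₂ B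
    where
    base₁ : ∀ A → + 2 * + 1 ≡ 1ℤ * (+ 2 * 1ℤ - A * 0ℤ)
    base₁ = solve-∀
    base₂ : ∀ B → + 2 * + 0 ≡ 1ℤ * (B * 0ℤ)
    base₂ = solve-∀
  powD≡lucas (suc n) = trace , coefficient
    where
    w : ℤ
    w = (+ 2) ^ n
    ihX : + 2 * X n ≡ w * V n
    ihX = proj₁ (powD≡lucas n)
    ihY : + 2 * Y n ≡ w * (B * U n)
    ihY = proj₂ (powD≡lucas n)
    trace : + 2 * X (suc n) ≡ + 2 * w * V (suc n)
    trace = begin
      + 2 * (A * X n + D * (B * Y n))            ≡⟨ distribute A D B (X n) (Y n) ⟩
      A * (+ 2 * X n) + D * (B * (+ 2 * Y n))    ≡⟨ cong₂ (λ x y → A * x + D * (B * y)) ihX ihY ⟩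
      A * (w * V n) + D * (B * (w * (B * U n)))  ≡⟨ collect A D B w (V n) (U n) ⟩
      w * (A * V n + D * (B * B) * U n)          ≡⟨ cong (λ δ → w * (A * V n + δ * U n)) discriminant≡DB² ⟨
      w * (A * V n + discriminant A Q * U n)     ≡⟨ cong (w *_) (lucasV-suc A Q n) ⟨
      w * (+ 2 * V (suc n))                      ≡⟨ double w (V (suc n)) ⟩
      + 2 * w * V (suc n)                        ∎
      where
      distribute : ∀ A D B x y → + 2 * (A * x + D * (B * y)) ≡ A * (+ 2 * x) + D * (B * (+ 2 * y))
      distribute = solve-∀
      collect : ∀ A D B w v u → A * (w * v) + D * (B * (w * (B * u))) ≡ w * (A * v + D * (B * B) * u)
      collect = solve-∀
      double : ∀ w v → w * (+ 2 * v) ≡ + 2 * w * v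
      double = solve-∀
    coefficient : + 2 * Y (suc n) ≡ + 2 * w * (B * U (suc n))
    coefficient = begin
      + 2 * (A * Y n + B * X n)            ≡⟨ distribute A B (Y n) (X n) ⟩
      A * (+ 2 * Y n) + B * (+ 2 * X n)    ≡⟨ cong₂ (λ y x → A * y + B * x) ihY ihX ⟩
      A * (w * (B * U n)) + B * (w * V n)  ≡⟨ collect A B w (U (suc n)) (U n) ⟩
      + 2 * w * (B * U (suc n))            ∎
      where
      distribute : ∀ A B y x → + 2 * (A * y + B * x) ≡ A * (+ 2 * y) + B * (+ 2 * x)
      distribute = solve-∀
      collect : ∀ A B w u′ u → A * (w * (B * u)) + B * (w * (+ 2 * u′ - A * u)) ≡ + 2 * w * (B * u′)
      collect = solve-∀

  pow-norm : ∀ n → V n * V n - D * ((B * U n) * (B * U n)) ≡ Q ^ n * + 4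
  pow-norm n = begin
    V n * V n - D * ((B * U n) * (B * U n))     ≡⟨ cong (_-_ (V n * V n)) (regroup D B (U n)) ⟩
    V n * V n - D * (B * B) * (U n * U n)       ≡⟨ cong (λ δ → V n * V n - δ * (U n * U n)) discriminant≡DB² ⟨
    V n * V n - discriminant A Q * (U n * U n)  ≡⟨ lucas-norm A Q n ⟩
    Q ^ n * + 4                                 ∎
    where
    regroup : ∀ D B u → D * ((B * u) * (B * u)) ≡ D * (B * B) * (u * u)
    regroup = solve-∀

  powCongOne⇔congOne : ∀ n M → PowCongOne D A B n M ⇔ CongOne D (V n) (B * U n) M
  powCongOne⇔congOne n M = mk⇔
    (λ (x , y , x∈O , eqX , eqY) → x , y , x∈O , cancel (trans (sym trace) eqX) , cancel (trans (sym ihY) eqY))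
    (λ (x , y , x∈O , eqV , eqW) → x , y , x∈O , trans trace (cong (w *_) eqV) , trans ihY (cong (w *_) eqW))
    where
    w : ℤ
    w = (+ 2) ^ n
    ihY : + 2 * Y n ≡ w * (B * U n)
    ihY = proj₂ (powD≡lucas n)
    cancel : ∀ {a b} → w * a ≡ w * b → a ≡ b
    cancel = *-cancelˡ-≡ w _ _ {{^-nonZero (+ 2) n}}
    trace : + 2 * (X n - w) ≡ w * (V n - + 2)
    trace = begin
      + 2 * (X n - w)      ≡⟨ expand (X n) w ⟩
      + 2 * X n - w * + 2  ≡⟨ cong (_- w * + 2) (proj₁ (powD≡lucas n)) ⟩
      w * V n - w * + 2    ≡⟨ factor w (V n) ⟩
      w * (V n - + 2)      ∎
      where
      expand : ∀ x w → + 2 * (x - w) ≡ + 2 * x - w * + 2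
      expand = solve-∀
      factor : ∀ w v → w * v - w * + 2 ≡ w * (v - + 2)
      factor = solve-∀

quotient-inOK : ∀ {D M V W x y} .{{_ : NonZero M}} → Coprime M (+ 2) →
  V * V - D * (W * W) ≡ + 4 → V - + 2 ≡ M * x → W ≡ M * y → InOK D x y
quotient-inOK {D} {M} {V} {W} {x} {y} M-odd norm₁ eqV eqW =
  ∣⇒∣ᵤ (coprime-divisor {+ 4} {M} 4⊥M (divides (- x) (*-cancelˡ-≡ M _ _ M²N≡M[-x·4])))
  where
  open ≡-Reasoning
  4⊥M : Coprime (+ 4) M
  4⊥M = ℤ.sym {M} {+ 4} (coprime-*ʳ {M} {+ 2} {+ 2} M-odd M-odd)
  M²N≡M[-x·4] : M * (M * (x * x - D * (y * y))) ≡ M * (- x * + 4)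
  M²N≡M[-x·4] = begin
    M * (M * (x * x - D * (y * y)))                ≡⟨ expand M D x y ⟩
    M * x * (M * x) - D * (M * y * (M * y))        ≡⟨ cong₂ (λ a b → a * a - D * (b * b)) eqV eqW ⟨
    (V - + 2) * (V - + 2) - D * (W * W)            ≡⟨ shift D V W ⟩
    (V * V - D * (W * W)) - + 4 * (V - + 2) - + 4  ≡⟨ cong₂ (λ n v → n - + 4 * v - + 4) norm₁ eqV ⟩
    + 4 - + 4 * (M * x) - + 4                      ≡⟨ collect M x ⟩
    M * (- x * + 4)                                ∎
    where
    expand : ∀ M D x y → M * (M * (x * x - D * (y * y))) ≡ M * x * (M * x) - D * (M * y * (M * y))
    expand = solve-∀
    shift : ∀ D V W → (V - + 2) * (V - + 2) - D * (W * W) ≡ (V * V - D * (W * W)) - + 4 * (V - + 2) - + 4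
    shift = solve-∀
    collect : ∀ M x → + 4 - + 4 * (M * x) - + 4 ≡ M * (- x * + 4)
    collect = solve-∀

congOne⇔∣ : ∀ {D V W M} .{{_ : NonZero M}} → Coprime M (+ 2) → V * V - D * (W * W) ≡ + 4 →
  CongOne D V W M ⇔ (V ≡ + 2 mod M × M ∣ W)
congOne⇔∣ {D} {V} {W} {M} M-odd norm₁ = mk⇔ to from
  where
  to : CongOne D V W M → V ≡ + 2 mod M × M ∣ W
  to (x , y , _ , eqV , eqW) = divides x (trans eqV (*-comm M x)) , divides y (trans eqW (*-comm M y))
  from : V ≡ + 2 mod M × M ∣ W → CongOne D V W M
  from (divides x eqV , divides y eqW) =
    x , y , quotient-inOK {D} {M} {V} {W} M-odd norm₁ eqV′ eqW′ , eqV′ , eqW′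
    where
    eqV′ : V - + 2 ≡ M * x
    eqV′ = trans eqV (*-comm x M)
    eqW′ : W ≡ M * y
    eqW′ = trans eqW (*-comm y M)

∣A⇒∤B : HasNorm D A B -1ℤ → Prime p → 2 ℕ.< p → + p ∣ A → ¬ (+ p ∣ B)
∣A⇒∤B {D} {A} {B} {p} norm p-prime 2<p p∣A p∣B =
  ℕ.<⇒≱ 2<p (ℕ.∣⇒≤ (reduce (euclidsLemma 2 2 p-prime (∣⇒∣ᵤ p∣4·-1))))
  where
  p∣4·-1 : + p ∣ + 4 * -1ℤ
  p∣4·-1 = subst (+ p ∣_) norm (∣m∣n⇒∣m-n (∣m⇒∣m*n A p∣A) (∣n⇒∣m*n D (∣m⇒∣m*n B p∣B)))

p²∣BU[2m]⇒p²∣A : Prime p → ¬ (+ p ∣ B) → ¬ (+ p ∣ + m) → + p ∣ A →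
  + p * + p ∣ B * lucasU A -1ℤ (m ℕ.* 2) → + p * + p ∣ A
p²∣BU[2m]⇒p²∣A {p} {B} {m} p-prime p∤B p∤m p∣A@(divides a refl) p²∣BU =
  *-monoˡ-∣ P (euclidsLemma-∤ p-prime p∤m (euclidsLemma-∤ p-prime p∤B p∣B[ma]))
  where
  P U : ℤ
  P = + p
  U = lucasU (a * P) -1ℤ (m ℕ.* 2)
  p²∣A² : P * P ∣ (a * P) * (a * P)
  p²∣A² = ∣-trans (*-monoˡ-∣ P p∣A) (*-monoʳ-∣ (a * P) p∣A)
  p²∣B[mA] : P * P ∣ B * (+ m * (a * P))
  p²∣B[mA] = subst (P * P ∣_) (cancel B U (+ m * (a * P)))
    (∣m∣n⇒∣m-n p²∣BU (∣n⇒∣m*n B (∣-trans p²∣A² (lucasU-even≡jP (a * P) m))))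
    where
    cancel : ∀ b u c → b * u - b * (u - c) ≡ b * c
    cancel = solve-∀
  p∣B[ma] : P ∣ B * (+ m * a)
  p∣B[ma] = *-cancelʳ-∣ P {{prime⇒nonZero p-prime}} (subst (P * P ∣_) (regroup B (+ m) a P) p²∣B[mA])
    where
    regroup : ∀ b j a P → b * (j * (a * P)) ≡ b * (j * a) * P
    regroup = solve-∀

congOne⇔p²∣A : HasNorm D A B -1ℤ → Prime p → 2 ℕ.< p → + p ∣ A →
  CongOne D (lucasV A -1ℤ (p ∸ 1)) (B * lucasU A -1ℤ (p ∸ 1)) (+ p * + p) ⇔ + p * + p ∣ A
congOne⇔p²∣A {D} {A} {B} norm p-prime 2<p p∣A with odd-prime p-prime 2<p
... | m , refl =
  ⇔-trans (congOne⇔∣ {D} {V} {W} {{i*j≢0 P P}} (prime²-coprime-2 p-prime 2<p) norm-tᵖ⁻¹)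
          (mk⇔ forward backward)
  where
  P V W : ℤ
  P = + suc (m ℕ.* 2)
  V = lucasV A -1ℤ (m ℕ.* 2)
  W = B * lucasU A -1ℤ (m ℕ.* 2)
  norm-tᵖ⁻¹ : V * V - D * (W * W) ≡ + 4
  norm-tᵖ⁻¹ = trans (pow-norm {D} {A} {B} norm (m ℕ.* 2)) (cong (_* + 4) (-1^even≡1 m))
  forward : V ≡ + 2 mod P * P × P * P ∣ W → P * P ∣ A
  forward = p²∣BU[2m]⇒p²∣A {B = B} p-prime (∣A⇒∤B {D} norm p-prime 2<p p∣A) (odd∤half {m} 2<p) p∣A ∘ proj₂
  backward : P * P ∣ A → V ≡ + 2 mod P * P × P * P ∣ W
  backward p²∣A = ∣-trans p²∣A (lucasV-even≡2 A m) , ∣n⇒∣m*n B (∣-trans p²∣A (P∣lucasU-even A m))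

lemma2p4 : (D : ℕ) → 2 ℕ.≤ D → SquareFree D →
           (p : ℕ) → Prime p → 2 ℕ.< p → SplitsIn p D →
           (A B : ℤ) → IsUnitOK (+ D) A B → HasNorm (+ D) A B (- (+ 1)) →
           DivZHalf (+ p) A →
           (PowCongOne (+ D) A B (p ∸ 1) ((+ p) * (+ p)) ⇔ DivZHalf ((+ p) * (+ p)) A)
lemma2p4 D _ _ p p-prime 2<p _ A B _ norm p∣A = begin
  PowCongOne (+ D) A B (p ∸ 1) (+ p * + p)
    ≈⟨ powCongOne⇔congOne norm (p ∸ 1) (+ p * + p) ⟩
  CongOne (+ D) (lucasV A -1ℤ (p ∸ 1)) (B * lucasU A -1ℤ (p ∸ 1)) (+ p * + p)
    ≈⟨ congOne⇔p²∣A {+ D} {A} {B} norm p-prime 2<p (Equivalence.to (divZHalf⇔∣ {+ p} {A} p⊥2) p∣A) ⟩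
  + p * + p ∣ A
    ≈⟨ divZHalf⇔∣ (prime²-coprime-2 p-prime 2<p) ⟨
  DivZHalf (+ p * + p) A
    ∎
  where
  open ⇔-Reasoning (⇔-setoid 0ℓ)
  p⊥2 : Coprime (+ p) (+ 2)
  p⊥2 = prime⇒coprime p-prime 2<p
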